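{- Let $S=\{x_1,x_2,\ldots,x_8\}$ be a gcd-closed set of eight distinct positive integers with $|G_S(x_8)|=3$ and $|D_S(x_8)|=4$. Then $(S)\mid[S]$ if and only if $S$ satisfies the condition $\mathfrak{M}$.
   Context: $S$ is gcd-closed if $\gcd(x,y)\in S$ for all $x,y\in S$. The GCD matrix $(S)$ is the $8\times8$ matrix with $(i,j)$-entry $\gcd(x_i,x_j)$; the LCM matrix $[S]$ has $(i,j)$-entry $\mathrm{lcm}(x_i,x_j)$. For $A,B\in M_8(\mathbb{Z})$, $A\mid B$ means there is $C\in M_8(\mathbb{Z})$ with $B=AC$ or $B=CA$. For $x<y$ in $S$, $x$ is a greatest-type divisor of $y$ in $S$ if $x\mid y$ and $x\mid z\mid y$, $z\in S$ imply $z\in\{x,y\}$; $G_S(y)$ is the set of greatest-type divisors of $y$ in $S$. If $G_S(x)=\{y_1,\ldots,y_k\}$, then $D_S(x)=\{\gcd(y_{i_1},\ldots,y_{i_r}): 2\le r\le k,\ 1\le i_1<\cdots<i_r\le k\}$. An element $x\in S$ with $|G_S(x)|\ge2$ satisfies condition $\mathfrak{M}$ if $\mathrm{lcm}(y,y')=x$ for all distinct $y,y'\in G_S(x)$; the set $S$ satisfies condition $\mathfrak{M}$ if every $x\in S$ with $|G_S(x)|\ge2$ satisfies it. -}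

module Defs where

open import Data.Nat using (ℕ; zero; suc; _<_; _≤_)
open import Data.Nat.Divisibility using (_∣_)
open import Data.Nat.GCD using (gcd)
open import Data.Nat.LCM using (lcm)
open import Data.Integer as ℤ using (ℤ; +_)
open import Data.Fin using (Fin; zero; suc)
open import Data.Fin.Subset using (Subset; _∈_; ∣_∣)
open import Data.Vec using (lookup)
open import Data.Bool using (true; false)
open import Data.Product using (Σ; ∃; _×_; _,_)
open import Data.Sum using (_⊎_)
open import Function.Definitions using (Injective)
open import Function.Bundles using (_⇔_)
open import Relation.Binary.PropositionalEquality using (_≡_; _≢_)

-- A finite set S = {x_1 < ... < x_n} of positive integers, given as a
-- strictly increasing family x : Fin n → ℕ (indices 0..n-1).
StrictlyIncreasing : ∀ {n} → (Fin n → ℕ) → Set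
StrictlyIncreasing {n} x = ∀ (i j : Fin n) → Data.Fin._<_ i j → x i < x j

Positive : ∀ {n} → (Fin n → ℕ) → Set
Positive {n} x = ∀ (i : Fin n) → 0 < x i

InS : ∀ {n} → (Fin n → ℕ) → ℕ → Set
InS {n} x z = ∃ λ (i : Fin n) → x i ≡ z

GcdClosed : ∀ {n} → (Fin n → ℕ) → Set
GcdClosed {n} x = ∀ (i j : Fin n) → InS x (gcd (x i) (x j))

HasCard : (ℕ → Set) → ℕ → Set
HasCard P k = Σ (Fin k → ℕ) λ v → Injective _≡_ _≡_ v × (∀ z → P z ⇔ (∃ λ j → v j ≡ z))

AtLeastTwo : (ℕ → Set) → Set
AtLeastTwo P = ∃ λ a → ∃ λ b → a ≢ b × P a × P b

IsGTD : ∀ {n} → (Fin n → ℕ) → ℕ → ℕ → Set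
IsGTD x y z =
  InS x z × z < y × z ∣ y ×
  (∀ w → InS x w → z ∣ w → w ∣ y → w ≡ z ⊎ w ≡ y)

G : ∀ {n} → (Fin n → ℕ) → ℕ → ℕ → Set
G x y z = IsGTD x y z

-- gcd of the elements x_i with i in the subset T (gcd over the empty set is 0)
gcdOver : ∀ {n} → (Fin n → ℕ) → Subset n → ℕ
gcdOver {zero} x T = 0
gcdOver {suc n} x T with lookup T zero
... | true  = gcd (x zero) (gcdOver (λ i → x (suc i)) (Data.Vec.tail T))
... | false = gcdOver (λ i → x (suc i)) (Data.Vec.tail T)

D : ∀ {n} → (Fin n → ℕ) → ℕ → ℕ → Set
D {n} x y d = ∃ λ (T : Subset n) →
  (∀ i → i ∈ T → G x y (x i)) × 2 ≤ ∣ T ∣ × gcdOver x T ≡ d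

SatisfiesM : ∀ {n} → (Fin n → ℕ) → Set
SatisfiesM x = ∀ y → InS x y → AtLeastTwo (G x y) →
  ∀ z z' → G x y z → G x y z' → z ≢ z' → lcm z z' ≡ y

Matrix : ℕ → Set
Matrix n = Fin n → Fin n → ℤ

sumFin : ∀ {n} → (Fin n → ℤ) → ℤ
sumFin {zero} f = + 0
sumFin {suc n} f = f zero ℤ.+ sumFin (λ i → f (suc i))

_⊗_ : ∀ {n} → Matrix n → Matrix n → Matrix n
(A ⊗ B) i j = sumFin (λ k → A i k ℤ.* B k j)

_∣ₘ_ : ∀ {n} → Matrix n → Matrix n → Set
_∣ₘ_ {n} A B = ∃ λ (C : Matrix n) → (∀ i j → B i j ≡ (A ⊗ C) i j) ⊎ (∀ i j → B i j ≡ (C ⊗ A) i j)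

GCDMatrix : ∀ {n} → (Fin n → ℕ) → Matrix n
GCDMatrix x i j = + gcd (x i) (x j)

LCMMatrix : ∀ {n} → (Fin n → ℕ) → Matrix n
LCMMatrix x i j = + lcm (x i) (x j)

-- Let m = x₈ have greatest-type divisors y₀, y₁, y₂ and put γ V = gcd (m, y_k : k ∈ V)
-- for V ⊆ {0, 1, 2}. Since gcd (γ V) (γ W) = γ (V ∪ W), all γ V lie in the gcd-closed set S;
-- |D_S(m)| = 4 makes γ injective, so S is exactly the image of the Boolean cube and the
-- greatest-type divisors of γ V are the γ W with W covering V. Condition 𝔐 thus says that
-- lcm (γ W) (γ W′) = γ V for any two covers W, W′ of V.
--
-- If 𝔐 holds, then γ V · ∏_{k ∈ V} (m / y_k) = m for all V, hence lcm (γ S) (γ T) = γ (S ∩ T),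
-- and [S] = (S) C where the column of C at γ T has the single entry ∏_{k ∉ T} (m / y_k), in
-- the row of γ (∁ T).
--
-- Conversely, if [S] = (S) C, each column of [S] is, as a function of V, an integer
-- combination of the functions V ↦ γ (V ∪ U). A Möbius sum over an upper interval [Y, full]
-- kills those with U ⊈ Y and turns the others into the Möbius sum α_Y of γ, so α_Y divides
-- the Möbius sum of every column. For Y an atom below the coatoms P, Q, the column of P has
-- Möbius sum n = y − lcm (P, Q) ≥ 0, while α_Y = n + r with r > 0; so n = 0, which is 𝔐 at y.
-- The same argument over the whole cube gives 𝔐 at m.

module Submission where

open import Defs
open import Data.Nat using (ℕ)
open import Data.Fin using (Fin; fromℕ)
open import Function.Bundles using (_⇔_)

open import Data.Bool using (Bool; true; false; not; _∨_; _∧_; f≤t; b≤b) renaming (_≤_ to _≤ᵇ_)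
import Data.Bool.Properties as Bool
open import Data.Empty using (⊥-elim)
open import Data.Fin using (zero; suc)
open import Data.Fin.Patterns using (0F; 1F; 2F)
open import Data.Fin.Properties using (suc-injective; any?; <⇒notInjective; <-cmp; 2↔Bool; *↔×) renaming (_≟_ to _≟ᶠ_)
open import Data.Fin.Subset using (Subset; _∈_; ∣_∣)
open import Data.Integer as ℤ using (ℤ; +_; _-_)
open import Data.Integer.Divisibility using () renaming (_∣_ to _∣ℤ_)
import Data.Integer.Properties as ℤ
import Data.Integer.Tactic.RingSolver as ℤ-Solver
open import Data.List using (List; []; _∷_)
open import Data.List.Membership.Propositional using () renaming (_∈_ to _∈ˡ_)
open import Data.List.Relation.Unary.Any using (here; there)
open import Data.Nat using (zero; suc; _+_; _*_; _<_; _≤_; s≤s; z≤n; >-nonZero)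
open import Data.Nat.Divisibility using (_∣_; divides; quotient; ∣-antisym; ∣-refl; ∣-trans; ∣⇒≤; m∣m*n)
open import Data.Nat.GCD using (gcd; gcd-assoc; gcd-comm; gcd-greatest; gcd-identityˡ; gcd-identityʳ; gcd[m,n]∣m; gcd[m,n]∣n; gcd[m,n]≢0)
open import Data.Nat.LCM using (lcm; lcm-comm; lcm-least; m∣lcm[m,n]; n∣lcm[m,n]; gcd*lcm)
open import Data.Nat.Properties
  using (_≟_; +-identityʳ; *-comm; *-assoc; *-identityʳ; *-identityˡ; *-cancelʳ-≡; <-irrefl; <-≤-trans; ≤∧≢⇒<;
         m<m+n; m≤n⇒∃[o]m+o≡n; n≮0; n≢0⇒n>0; n<1+n; *-commutativeSemigroup)
open import Algebra.Properties.CommutativeSemigroup *-commutativeSemigroup using (interchange)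
import Data.Nat.Tactic.RingSolver as ℕ-Solver
open import Data.Product using (_×_; _,_; ∃; ∃₂; proj₁; proj₂)
open import Data.Product.Function.NonDependent.Propositional using (_×-↔_)
open import Data.Product.Properties using (≡-dec)
open import Data.Sum using (_⊎_; inj₁; inj₂; [_,_]′)
open import Data.Vec using (_∷_; [])
open import Data.Vec.Base using (here; there)
open import Function.Base using (_∘_)
open import Function.Bundles using (_↔_; Injection; Equivalence; mk⇔)
open import Function.Definitions using (Injective)
open import Function.Properties.Inverse using (↔-trans; ↔⇒↣)
open import Relation.Binary.Definitions using (DecidableEquality; tri<; tri≈; tri>)
open import Relation.Binary.PropositionalEquality
open import Relation.Nullary using (yes; no)
open ≡-Reasoning

-- Boolean cube

Cube : Set
Cube = Bool × Bool × Bool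

infixr 7 _∩_
infixr 6 _∪_
infix 4 _⊑_ _⋖_

_∪_ _∩_ : Cube → Cube → Cube
(a , b , c) ∪ (a′ , b′ , c′) = a ∨ a′ , b ∨ b′ , c ∨ c′
(a , b , c) ∩ (a′ , b′ , c′) = a ∧ a′ , b ∧ b′ , c ∧ c′

∁ : Cube → Cube
∁ (a , b , c) = not a , not b , not c

∅ full : Cube
∅ = false , false , false
full = true , true , true

bit : Fin 3 → Cube → Bool
bit 0F (a , _ , _) = a
bit 1F (_ , b , _) = b
bit 2F (_ , _ , c) = c

atom coatom : Fin 3 → Cube
atom 0F = true , false , false
atom 1F = false , true , false
atom 2F = false , false , true
coatom k = ∁ (atom k)

_≟ᶜ_ : DecidableEquality Cube
_≟ᶜ_ = ≡-dec Bool._≟_ (≡-dec Bool._≟_ Bool._≟_)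

_⊑_ : Cube → Cube → Set
(a , b , c) ⊑ (a′ , b′ , c′) = a ≤ᵇ a′ × b ≤ᵇ b′ × c ≤ᵇ c′

data _⋖_ : Cube → Cube → Set where
  cover₁ : ∀ {b c} → (false , b , c) ⋖ (true , b , c)
  cover₂ : ∀ {a c} → (a , false , c) ⋖ (a , true , c)
  cover₃ : ∀ {a b} → (a , b , false) ⋖ (a , b , true)

cube-≡ : ∀ {a a′ b b′ c c′ : Bool} → a ≡ a′ → b ≡ b′ → c ≡ c′ → (a , b , c) ≡ (a′ , b′ , c′)
cube-≡ refl refl refl = refl

private
  ≤⇒∨≡ : ∀ {a b} → a ≤ᵇ b → a ∨ b ≡ b
  ≤⇒∨≡ f≤t = refl
  ≤⇒∨≡ {a} b≤b = Bool.∨-idem a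

  ∨≡⇒≤ : ∀ a b → a ∨ b ≡ b → a ≤ᵇ b
  ∨≡⇒≤ false b _ = Bool.≤-minimum b
  ∨≡⇒≤ true true _ = b≤b
  ∨≡⇒≤ true false ()

  ≤-∨ʳ : ∀ a b → a ≤ᵇ a ∨ b
  ≤-∨ʳ false b = Bool.≤-minimum b
  ≤-∨ʳ true b = b≤b

  ∨-lub : ∀ {a b c} → a ≤ᵇ c → b ≤ᵇ c → a ∨ b ≤ᵇ c
  ∨-lub {false} _ q = q
  ∨-lub {true} p _ = p

  ≤-or-escapes : ∀ a b → a ≤ᵇ b ⊎ (a ≡ true × b ≡ false)
  ≤-or-escapes false b = inj₁ (Bool.≤-minimum b)
  ≤-or-escapes true true = inj₁ b≤b
  ≤-or-escapes true false = inj₂ (refl , refl)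

  ∨-swap : ∀ a b c → (a ∨ b) ∨ c ≡ (a ∨ c) ∨ b
  ∨-swap a b c = trans (Bool.∨-assoc a b c) (trans (cong (a ∨_) (Bool.∨-comm b c)) (sym (Bool.∨-assoc a c b)))

⊑-refl : ∀ {V} → V ⊑ V
⊑-refl = b≤b , b≤b , b≤b

⊑-trans : ∀ {U V W} → U ⊑ V → V ⊑ W → U ⊑ W
⊑-trans (p , q , r) (p′ , q′ , r′) = Bool.≤-trans p p′ , Bool.≤-trans q q′ , Bool.≤-trans r r′

⊑⇒∪≡ : ∀ {V W} → V ⊑ W → V ∪ W ≡ W
⊑⇒∪≡ (p , q , r) = cube-≡ (≤⇒∨≡ p) (≤⇒∨≡ q) (≤⇒∨≡ r)

∪≡⇒⊑ : ∀ V W → V ∪ W ≡ W → V ⊑ W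
∪≡⇒⊑ (a , b , c) (a′ , b′ , c′) e =
  ∨≡⇒≤ a a′ (cong proj₁ e) , ∨≡⇒≤ b b′ (cong (proj₁ ∘ proj₂) e) , ∨≡⇒≤ c c′ (cong (proj₂ ∘ proj₂) e)

∪-upperˡ : ∀ V W → V ⊑ V ∪ W
∪-upperˡ (a , b , c) (a′ , b′ , c′) = ≤-∨ʳ a a′ , ≤-∨ʳ b b′ , ≤-∨ʳ c c′

∪-comm : ∀ V W → V ∪ W ≡ W ∪ V
∪-comm (a , b , c) (a′ , b′ , c′) = cube-≡ (Bool.∨-comm a a′) (Bool.∨-comm b b′) (Bool.∨-comm c c′)

∪-upperʳ : ∀ V W → W ⊑ V ∪ W
∪-upperʳ V W = subst (W ⊑_) (∪-comm W V) (∪-upperˡ W V)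

∪-least : ∀ {U V W} → U ⊑ W → V ⊑ W → U ∪ V ⊑ W
∪-least (p , q , r) (p′ , q′ , r′) = ∨-lub p p′ , ∨-lub q q′ , ∨-lub r r′

∪-swap : ∀ U V W → (U ∪ V) ∪ W ≡ (U ∪ W) ∪ V
∪-swap (a , b , c) (a′ , b′ , c′) (a″ , b″ , c″) = cube-≡ (∨-swap a a′ a″) (∨-swap b b′ b″) (∨-swap c c′ c″)

atom⊑ : ∀ k V → bit k V ≡ true → atom k ⊑ V
atom⊑ 0F (true , b , c) refl = b≤b , Bool.≤-minimum b , Bool.≤-minimum c
atom⊑ 1F (a , true , c) refl = Bool.≤-minimum a , b≤b , Bool.≤-minimum c
atom⊑ 2F (a , b , true) refl = Bool.≤-minimum a , Bool.≤-minimum b , b≤b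

⊑-or-escapes : ∀ U V → U ⊑ V ⊎ ∃ λ k → bit k U ≡ true × bit k V ≡ false
⊑-or-escapes (a , b , c) (a′ , b′ , c′) with ≤-or-escapes a a′ | ≤-or-escapes b b′ | ≤-or-escapes c c′
... | inj₂ e | _ | _ = inj₂ (0F , e)
... | inj₁ _ | inj₂ e | _ = inj₂ (1F , e)
... | inj₁ _ | inj₁ _ | inj₂ e = inj₂ (2F , e)
... | inj₁ p | inj₁ q | inj₁ r = inj₁ (p , q , r)

⋖⇒⊑ : ∀ {V W} → V ⋖ W → V ⊑ W
⋖⇒⊑ cover₁ = f≤t , b≤b , b≤b
⋖⇒⊑ cover₂ = b≤b , f≤t , b≤b
⋖⇒⊑ cover₃ = b≤b , b≤b , f≤t

⋖⇒≢ : ∀ {V W} → V ⋖ W → V ≢ W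
⋖⇒≢ cover₁ ()
⋖⇒≢ cover₂ ()
⋖⇒≢ cover₃ ()

⋖-between : ∀ {U V W} → V ⋖ W → V ⊑ U → U ⊑ W → U ≡ V ⊎ U ≡ W
⋖-between {false , _ , _} cover₁ (_ , p , q) (_ , p′ , q′) = inj₁ (cube-≡ refl (Bool.≤-antisym p′ p) (Bool.≤-antisym q′ q))
⋖-between {true , _ , _} cover₁ (_ , p , q) (_ , p′ , q′) = inj₂ (cube-≡ refl (Bool.≤-antisym p′ p) (Bool.≤-antisym q′ q))
⋖-between {_ , false , _} cover₂ (p , _ , q) (p′ , _ , q′) = inj₁ (cube-≡ (Bool.≤-antisym p′ p) refl (Bool.≤-antisym q′ q))
⋖-between {_ , true , _} cover₂ (p , _ , q) (p′ , _ , q′) = inj₂ (cube-≡ (Bool.≤-antisym p′ p) refl (Bool.≤-antisym q′ q))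
⋖-between {_ , _ , false} cover₃ (p , q , _) (p′ , q′ , _) = inj₁ (cube-≡ (Bool.≤-antisym p′ p) (Bool.≤-antisym q′ q) refl)
⋖-between {_ , _ , true} cover₃ (p , q , _) (p′ , q′ , _) = inj₂ (cube-≡ (Bool.≤-antisym p′ p) (Bool.≤-antisym q′ q) refl)

⊏⇒⋖⊑ : ∀ {V W} → V ⊑ W → V ≢ W → ∃ λ V′ → V ⋖ V′ × V′ ⊑ W
⊏⇒⋖⊑ (f≤t , q , r) _ = _ , cover₁ , b≤b , q , r
⊏⇒⋖⊑ (b≤b , f≤t , r) _ = _ , cover₂ , b≤b , b≤b , r
⊏⇒⋖⊑ (b≤b , b≤b , f≤t) _ = _ , cover₃ , b≤b , b≤b , b≤b
⊏⇒⋖⊑ (b≤b , b≤b , b≤b) V≢W = ⊥-elim (V≢W refl)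

⊑-full : ∀ V → V ⊑ full
⊑-full (a , b , c) = Bool.≤-maximum a , Bool.≤-maximum b , Bool.≤-maximum c

coatom⋖full : ∀ k → coatom k ⋖ full
coatom⋖full 0F = cover₁
coatom⋖full 1F = cover₂
coatom⋖full 2F = cover₃

atoms-join : ∀ {k k′} → k ≢ k′ → ∃ λ j → atom k ∪ atom k′ ≡ coatom j
atoms-join {0F} {0F} k≢k′ = ⊥-elim (k≢k′ refl)
atoms-join {0F} {1F} _ = 2F , refl
atoms-join {0F} {2F} _ = 1F , refl
atoms-join {1F} {0F} _ = 2F , refl
atoms-join {1F} {1F} k≢k′ = ⊥-elim (k≢k′ refl)
atoms-join {1F} {2F} _ = 0F , refl
atoms-join {2F} {0F} _ = 1F , refl
atoms-join {2F} {1F} _ = 0F , refl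
atoms-join {2F} {2F} k≢k′ = ⊥-elim (k≢k′ refl)

⋖-meet : ∀ {V W W′} → V ⋖ W → V ⋖ W′ → W ≢ W′ → W ∩ W′ ≡ V
⋖-meet cover₁ cover₁ W≢W′ = ⊥-elim (W≢W′ refl)
⋖-meet cover₁ cover₂ _ = cube-≡ refl refl (Bool.∧-idem _)
⋖-meet cover₁ cover₃ _ = cube-≡ refl (Bool.∧-idem _) refl
⋖-meet cover₂ cover₁ _ = cube-≡ refl refl (Bool.∧-idem _)
⋖-meet cover₂ cover₂ W≢W′ = ⊥-elim (W≢W′ refl)
⋖-meet cover₂ cover₃ _ = cube-≡ (Bool.∧-idem _) refl refl
⋖-meet cover₃ cover₁ _ = cube-≡ refl (Bool.∧-idem _) refl
⋖-meet cover₃ cover₂ _ = cube-≡ (Bool.∧-idem _) refl refl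
⋖-meet cover₃ cover₃ W≢W′ = ⊥-elim (W≢W′ refl)

∁-∪-∩ : ∀ S T → ∁ T ∪ S ∩ T ≡ S ∪ ∁ T
∁-∪-∩ (a , b , c) (a′ , b′ , c′) = cube-≡ (lemma a a′) (lemma b b′) (lemma c c′)
  where
  lemma : ∀ p q → not q ∨ p ∧ q ≡ p ∨ not q
  lemma p true = trans (Bool.∧-identityʳ p) (sym (Bool.∨-identityʳ p))
  lemma p false = sym (Bool.∨-zeroʳ p)

∁-∩-∩ : ∀ S T → ∁ T ∩ S ∩ T ≡ ∅
∁-∩-∩ (a , b , c) (a′ , b′ , c′) = cube-≡ (lemma a a′) (lemma b b′) (lemma c c′)
  where
  lemma : ∀ p q → not q ∧ p ∧ q ≡ false
  lemma p true = refl
  lemma p false = Bool.∧-zeroʳ p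

∅⊑ : ∀ V → ∅ ⊑ V
∅⊑ (a , b , c) = Bool.≤-minimum a , Bool.≤-minimum b , Bool.≤-minimum c

atom⊑coatom : ∀ {k j} → k ≢ j → atom k ⊑ coatom j
atom⊑coatom {0F} {0F} k≢j = ⊥-elim (k≢j refl)
atom⊑coatom {0F} {1F} _ = atom⊑ 0F (coatom 1F) refl
atom⊑coatom {0F} {2F} _ = atom⊑ 0F (coatom 2F) refl
atom⊑coatom {1F} {0F} _ = atom⊑ 1F (coatom 0F) refl
atom⊑coatom {1F} {1F} k≢j = ⊥-elim (k≢j refl)
atom⊑coatom {1F} {2F} _ = atom⊑ 1F (coatom 2F) refl
atom⊑coatom {2F} {0F} _ = atom⊑ 2F (coatom 0F) refl
atom⊑coatom {2F} {1F} _ = atom⊑ 2F (coatom 1F) refl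
atom⊑coatom {2F} {2F} k≢j = ⊥-elim (k≢j refl)

fin8↔cube : Fin 8 ↔ Cube
fin8↔cube = ↔-trans (*↔× {2} {4}) (2↔Bool ×-↔ ↔-trans (*↔× {2} {2}) (2↔Bool ×-↔ 2↔Bool))

enumerate : Fin 8 → Cube
enumerate = Injection.to (↔⇒↣ fin8↔cube)

enumerate-injective : Injective _≡_ _≡_ enumerate
enumerate-injective = Injection.injective (↔⇒↣ fin8↔cube)

-- Möbius sums on the cube

sumFin-cong : ∀ {n} {f g : Fin n → ℤ} → (∀ k → f k ≡ g k) → sumFin f ≡ sumFin g
sumFin-cong {zero} _ = refl
sumFin-cong {suc n} eq = cong₂ ℤ._+_ (eq zero) (sumFin-cong (λ k → eq (suc k)))

sumFin-- : ∀ {n} (f g : Fin n → ℤ) → sumFin f - sumFin g ≡ sumFin (λ k → f k - g k)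
sumFin-- {zero} f g = refl
sumFin-- {suc n} f g = trans (split (f zero) (sumFin (f ∘ suc)) (g zero) (sumFin (g ∘ suc)))
    (cong (λ s → (f zero - g zero) ℤ.+ s) (sumFin-- (f ∘ suc) (g ∘ suc)))
  where
  split : ∀ a s b t → (a ℤ.+ s) - (b ℤ.+ t) ≡ (a - b) ℤ.+ (s - t)
  split = ℤ-Solver.solve-∀

sumFin-*ˡ : ∀ {n} (a : ℤ) (f : Fin n → ℤ) → sumFin (λ k → a ℤ.* f k) ≡ a ℤ.* sumFin f
sumFin-*ˡ {zero} a f = sym (ℤ.*-zeroʳ a)
sumFin-*ˡ {suc n} a f = trans (cong (λ s → a ℤ.* f zero ℤ.+ s) (sumFin-*ˡ a (λ k → f (suc k))))
  (sym (ℤ.*-distribˡ-+ a (f zero) (sumFin (λ k → f (suc k)))))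

sumFin-select : ∀ {n} (f : Fin n → ℤ) k₀ → (∀ k → k ≢ k₀ → f k ≡ + 0) → sumFin f ≡ f k₀
sumFin-select f zero others = trans (cong (λ s → f zero ℤ.+ s) (sumFin-zero (λ k → others (suc k) λ ()))) (ℤ.+-identityʳ (f zero))
  where
  sumFin-zero : ∀ {n} {h : Fin n → ℤ} → (∀ k → h k ≡ + 0) → sumFin h ≡ + 0
  sumFin-zero {zero} _ = refl
  sumFin-zero {suc n} h≡0 = cong₂ ℤ._+_ (h≡0 zero) (sumFin-zero (λ k → h≡0 (suc k)))
sumFin-select f (suc k₀) others = trans (cong (ℤ._+ sumFin (f ∘ suc)) (others zero λ ()))
  (trans (ℤ.+-identityˡ _) (sumFin-select (f ∘ suc) k₀ (λ k k≢k₀ → others (suc k) (k≢k₀ ∘ suc-injective))))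

-- When is lists the bits outside Y, ∇ is f Y is the Möbius sum Σ_{V ⊒ Y} (−1)^{|V ∖ Y|} f V.

Δ : Fin 3 → (Cube → ℤ) → Cube → ℤ
Δ i f V = f V - f (V ∪ atom i)

∇ : List (Fin 3) → (Cube → ℤ) → Cube → ℤ
∇ [] f = f
∇ (i ∷ is) f = Δ i (∇ is f)

Invariant : Fin 3 → (Cube → ℤ) → Set
Invariant i f = ∀ V → f (V ∪ atom i) ≡ f V

∇-local : ∀ {Y} {f g : Cube → ℤ} → (∀ V → Y ⊑ V → f V ≡ g V) → ∀ is V → Y ⊑ V → ∇ is f V ≡ ∇ is g V
∇-local eq [] V Y⊑V = eq V Y⊑V
∇-local eq (i ∷ is) V Y⊑V =
  cong₂ _-_ (∇-local eq is V Y⊑V) (∇-local eq is (V ∪ atom i) (⊑-trans Y⊑V (∪-upperˡ V (atom i))))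

∇-invariant : ∀ i f → Invariant i f → ∀ is → Invariant i (∇ is f)
∇-invariant i f inv [] = inv
∇-invariant i f inv (j ∷ is) V = cong₂ _-_ (∇-invariant i f inv is V) (begin
  ∇ is f ((V ∪ atom i) ∪ atom j) ≡⟨ cong (∇ is f) (∪-swap V (atom i) (atom j)) ⟩
  ∇ is f ((V ∪ atom j) ∪ atom i) ≡⟨ ∇-invariant i f inv is (V ∪ atom j) ⟩
  ∇ is f (V ∪ atom j)            ∎)

∇-vanishes : ∀ {i is} f → i ∈ˡ is → Invariant i f → ∀ V → ∇ is f V ≡ + 0
∇-vanishes {is = i ∷ is} f (here refl) inv V = ℤ.i≡j⇒i-j≡0 (sym (∇-invariant i f inv is V))
∇-vanishes f (there i∈is) inv V = cong₂ _-_ (∇-vanishes f i∈is inv V) (∇-vanishes f i∈is inv _)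

∇-linear : ∀ is {n} (h : Fin n → Cube → ℤ) (c : Fin n → ℤ) V →
  ∇ is (λ W → sumFin (λ k → h k W ℤ.* c k)) V ≡ sumFin (λ k → ∇ is (h k) V ℤ.* c k)
∇-linear [] h c V = refl
∇-linear (i ∷ is) h c V = begin
  ∇ is _ V - ∇ is _ (V ∪ atom i)
    ≡⟨ cong₂ _-_ (∇-linear is h c V) (∇-linear is h c (V ∪ atom i)) ⟩
  sumFin (λ k → ∇ is (h k) V ℤ.* c k) - sumFin (λ k → ∇ is (h k) (V ∪ atom i) ℤ.* c k)
    ≡⟨ sumFin-- (λ k → ∇ is (h k) V ℤ.* c k) (λ k → ∇ is (h k) (V ∪ atom i) ℤ.* c k) ⟩
  sumFin (λ k → ∇ is (h k) V ℤ.* c k - ∇ is (h k) (V ∪ atom i) ℤ.* c k)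
    ≡⟨ sumFin-cong (λ k → *-distribʳ-- (∇ is (h k) V) _ (c k)) ⟩
  sumFin (λ k → Δ i (∇ is (h k)) V ℤ.* c k) ∎
  where
  *-distribʳ-- : ∀ a b c → a ℤ.* c - b ℤ.* c ≡ (a - b) ℤ.* c
  *-distribʳ-- = ℤ-Solver.solve-∀

FreeIn : Cube → List (Fin 3) → Set
FreeIn Y is = ∀ k → bit k Y ≡ false → k ∈ˡ is

shift-invariant : ∀ {k U} (f : Cube → ℤ) → bit k U ≡ true → Invariant k (λ V → f (V ∪ U))
shift-invariant {k} {U} f Uk V = cong f (begin
  (V ∪ atom k) ∪ U ≡⟨ ∪-swap V (atom k) U ⟩
  (V ∪ U) ∪ atom k ≡⟨ ∪-comm (V ∪ U) (atom k) ⟩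
  atom k ∪ (V ∪ U) ≡⟨ ⊑⇒∪≡ (⊑-trans (atom⊑ k U Uk) (∪-upperʳ V U)) ⟩
  V ∪ U            ∎)

∇-shift : ∀ {Y is} → FreeIn Y is → ∀ (f : Cube → ℤ) U →
  ∃ λ ε → ∇ is (λ V → f (V ∪ U)) Y ≡ ∇ is f Y ℤ.* ε
∇-shift {Y} {is} free f U with ⊑-or-escapes U Y
... | inj₁ U⊑Y = + 1 , trans (∇-local absorbed is Y ⊑-refl) (sym (ℤ.*-identityʳ (∇ is f Y)))
  where
  absorbed : ∀ V → Y ⊑ V → f (V ∪ U) ≡ f V
  absorbed V Y⊑V = cong f (trans (∪-comm V U) (⊑⇒∪≡ (⊑-trans U⊑Y Y⊑V)))
... | inj₂ (k , Uk , Yk) = + 0 , trans (∇-vanishes _ (free k Yk) (shift-invariant {k} f Uk) Y) (sym (ℤ.*-zeroʳ (∇ is f Y)))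

∇-divides : ∀ {Y is n} → FreeIn Y is → (f F : Cube → ℤ) (U : Fin n → Cube) (c : Fin n → ℤ) →
  (∀ V → F V ≡ sumFin (λ k → f (V ∪ U k) ℤ.* c k)) → ∇ is f Y ∣ℤ ∇ is F Y
∇-divides {Y} {is} {n} free f F U c F≡ = subst (α ∣ℤ_) (sym F≡α*t) α∣α*t
  where
  α : ℤ
  α = ∇ is f Y
  ε : Fin n → ℤ
  ε k = proj₁ (∇-shift free f (U k))
  t : ℤ
  t = sumFin (λ k → ε k ℤ.* c k)
  F≡α*t : ∇ is F Y ≡ α ℤ.* t
  F≡α*t = begin
    ∇ is F Y ≡⟨ ∇-local (λ V _ → F≡ V) is Y ⊑-refl ⟩
    ∇ is (λ V → sumFin (λ k → f (V ∪ U k) ℤ.* c k)) Y ≡⟨ ∇-linear is (λ k V → f (V ∪ U k)) c Y ⟩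
    sumFin (λ k → ∇ is (λ V → f (V ∪ U k)) Y ℤ.* c k)
      ≡⟨ sumFin-cong (λ k → trans (cong (ℤ._* c k) (proj₂ (∇-shift free f (U k)))) (ℤ.*-assoc α (ε k) (c k))) ⟩
    sumFin (λ k → α ℤ.* (ε k ℤ.* c k)) ≡⟨ sumFin-*ˡ α (λ k → ε k ℤ.* c k) ⟩
    α ℤ.* t ∎
  α∣α*t : α ∣ℤ α ℤ.* t
  α∣α*t = subst (ℤ.∣ α ∣ ∣_) (sym (ℤ.abs-* α t)) (m∣m*n ℤ.∣ t ∣)

gcd-idem : ∀ n → gcd n n ≡ n
gcd-idem n = ∣-antisym (gcd[m,n]∣m n n) (gcd-greatest ∣-refl ∣-refl)

gcd-of-divisor : ∀ {m n} → n ∣ m → gcd m n ≡ n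
gcd-of-divisor {m} {n} n∣m = ∣-antisym (gcd[m,n]∣n m n) (gcd-greatest n∣m ∣-refl)

lcm-of-divisor : ∀ {m n} → n ∣ m → lcm m n ≡ m
lcm-of-divisor {m} {n} n∣m = ∣-antisym (lcm-least ∣-refl n∣m) (m∣lcm[m,n] m n)

lcm-idem : ∀ n → lcm n n ≡ n
lcm-idem n = lcm-of-divisor ∣-refl

gcd-interchange : ∀ a b c d → gcd (gcd a b) (gcd c d) ≡ gcd (gcd a c) (gcd b d)
gcd-interchange a b c d = begin
  gcd (gcd a b) (gcd c d) ≡⟨ gcd-assoc a b (gcd c d) ⟩
  gcd a (gcd b (gcd c d)) ≡⟨ cong (gcd a) (sym (gcd-assoc b c d)) ⟩
  gcd a (gcd (gcd b c) d) ≡⟨ cong (λ t → gcd a (gcd t d)) (gcd-comm b c) ⟩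
  gcd a (gcd (gcd c b) d) ≡⟨ cong (gcd a) (gcd-assoc c b d) ⟩
  gcd a (gcd c (gcd b d)) ≡⟨ gcd-assoc a c (gcd b d) ⟨
  gcd (gcd a c) (gcd b d) ∎

alt : ℤ → ℤ → ℤ → ℤ → ℤ
alt a b c d = (a - b) - (c - d)

alt-cong : ∀ {a a′ b b′ c c′ d d′} → a ≡ a′ → b ≡ b′ → c ≡ c′ → d ≡ d′ →
  alt (+ a) (+ b) (+ c) (+ d) ≡ alt (+ a′) (+ b′) (+ c′) (+ d′)
alt-cong refl refl refl refl = refl

diff-ℕ : ∀ {p q s} → p ≡ s + q → + p - + q ≡ + s
diff-ℕ {q = q} {s} refl = trans (cong (_- + q) (ℤ.pos-+ s q)) (cancel (+ s) (+ q))
  where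
  cancel : ∀ s q → (s ℤ.+ q) - q ≡ s
  cancel = ℤ-Solver.solve-∀

alt-ℕ : ∀ {a b c d s} → a + d ≡ s + (b + c) → alt (+ a) (+ b) (+ c) (+ d) ≡ + s
alt-ℕ {a} {b} {c} {d} eq = trans (rearrange (+ a) (+ b) (+ c) (+ d))
  (trans (cong₂ _-_ (sym (ℤ.pos-+ a d)) (sym (ℤ.pos-+ b c))) (diff-ℕ eq))
  where
  rearrange : ∀ a b c d → (a - b) - (c - d) ≡ (a ℤ.+ d) - (b ℤ.+ c)
  rearrange = ℤ-Solver.solve-∀

alt-alt-ℕ : ∀ {a b c d a′ b′ c′ d′ s} → a + d + b′ + c′ ≡ s + (b + c + a′ + d′) →
  alt (+ a) (+ b) (+ c) (+ d) - alt (+ a′) (+ b′) (+ c′) (+ d′) ≡ + s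
alt-alt-ℕ {a} {b} {c} {d} {a′} {b′} {c′} {d′} eq =
  trans (rearrange (+ a) (+ b) (+ c) (+ d) (+ a′) (+ b′) (+ c′) (+ d′))
    (trans (cong₂ _-_ (sym (+ℕ a d b′ c′)) (sym (+ℕ b c a′ d′))) (diff-ℕ eq))
  where
  rearrange : ∀ a b c d a′ b′ c′ d′ →
    ((a - b) - (c - d)) - ((a′ - b′) - (c′ - d′)) ≡ (a ℤ.+ d ℤ.+ b′ ℤ.+ c′) - (b ℤ.+ c ℤ.+ a′ ℤ.+ d′)
  rearrange = ℤ-Solver.solve-∀
  +ℕ : ∀ p q r t → + (p + q + r + t) ≡ + p ℤ.+ + q ℤ.+ + r ℤ.+ + t
  +ℕ p q r t = trans (ℤ.pos-+ (p + q + r) t) (cong (ℤ._+ + t) (trans (ℤ.pos-+ (p + q) r) (cong (ℤ._+ + r) (ℤ.pos-+ p q))))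

*-pos : ∀ {a b} → 0 < a → 0 < b → 0 < a * b
*-pos {suc _} {suc _} _ _ = s≤s z≤n

cancelʳ : ∀ {a b c} → 0 < c → a * c ≡ b * c → a ≡ b
cancelʳ {a} {b} {c} 0<c = *-cancelʳ-≡ a b c ⦃ >-nonZero 0<c ⦄

proper-multiple : ∀ {d P} → d ∣ P → d < P → ∃ λ a → P ≡ suc (suc a) * d
proper-multiple (divides zero refl) d<0 = ⊥-elim (n≮0 d<0)
proper-multiple {d} (divides (suc zero) refl) d<d+0 = ⊥-elim (<-irrefl (sym (+-identityʳ d)) d<d+0)
proper-multiple (divides (suc (suc a)) P≡) _ = a , P≡

quotient-of-product : ∀ {y P Q d A C} → 0 < d → y * d ≡ P * Q → P ≡ A * d → Q ≡ C * d → y ≡ A * C * d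
quotient-of-product {y} {P} {Q} {d} {A} {C} 0<d yd≡PQ P≡ Q≡ =
  cancelʳ 0<d (trans yd≡PQ (trans (cong₂ _*_ P≡ Q≡) (square-out A C d)))
  where
  square-out : ∀ a c d → (a * d) * (c * d) ≡ a * c * d * d
  square-out = ℕ-Solver.solve-∀

lcm*gcd : ∀ {P Q d} → gcd P Q ≡ d → lcm P Q * d ≡ P * Q
lcm*gcd {P} {Q} gcd≡d = trans (*-comm (lcm P Q) _) (trans (cong (_* lcm P Q) (sym gcd≡d)) (gcd*lcm P Q))

remainder-vanishes : ∀ {α s : ℤ} {n r} → α ∣ℤ s → s ≡ + n → α ≡ + (n + r) → 0 < r → n ≡ 0
remainder-vanishes {n = zero} _ _ _ _ = refl
remainder-vanishes {n = suc n} α∣s refl refl 0<r =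
  ⊥-elim (<-irrefl refl (<-≤-trans (m<m+n (suc n) 0<r) (∣⇒≤ α∣s)))

-- With P = A d, Q = C d (A, C ≥ 2) and y = lcm P Q + n, the divisor is n + (A - 1)(C - 1) d.
mobius-square⇒lcm : ∀ {y P Q d} → 0 < d → gcd P Q ≡ d → d < P → d < Q → lcm P Q ≤ y →
  alt (+ y) (+ Q) (+ P) (+ d) ∣ℤ alt (+ y) (+ lcm P Q) (+ P) (+ P) → y ≡ lcm P Q
mobius-square⇒lcm {y} {P} {Q} {d} 0<d gcd≡d d<P d<Q L≤y α∣
  with a , P≡ ← proper-multiple (subst (_∣ P) gcd≡d (gcd[m,n]∣m P Q)) d<P
     | c , Q≡ ← proper-multiple (subst (_∣ Q) gcd≡d (gcd[m,n]∣n P Q)) d<Q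
     | n , L+n≡y ← m≤n⇒∃[o]m+o≡n L≤y =
  trans (sym L+n≡y) (trans (cong (λ t → L + t) n≡0) (+-identityʳ L))
  where
  +-comm-middle : ∀ l n p → l + n + p ≡ n + (l + p)
  +-comm-middle = ℕ-Solver.solve-∀
  excess : ∀ a c d n →
    suc (suc a) * suc (suc c) * d + n + d ≡ n + suc a * suc c * d + (suc (suc c) * d + suc (suc a) * d)
  excess = ℕ-Solver.solve-∀
  L A C : ℕ
  L = lcm P Q
  A = suc (suc a)
  C = suc (suc c)
  L≡ : L ≡ A * C * d
  L≡ = quotient-of-product {A = A} {C} 0<d (lcm*gcd {P} {Q} gcd≡d) P≡ Q≡
  sum≡n : alt (+ y) (+ L) (+ P) (+ P) ≡ + n
  sum≡n = alt-ℕ {y} {L} {P} {P} {n} (trans (cong (_+ P) (sym L+n≡y)) (+-comm-middle L n P))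
  α≡n+r : alt (+ y) (+ Q) (+ P) (+ d) ≡ + (n + suc a * suc c * d)
  α≡n+r = alt-ℕ {y} {Q} {P} {d} {n + suc a * suc c * d} (begin
    y + d                 ≡⟨ cong (_+ d) (trans (sym L+n≡y) (cong (_+ n) L≡)) ⟩
    A * C * d + n + d     ≡⟨ excess a c d n ⟩
    n + suc a * suc c * d + (C * d + A * d) ≡⟨ cong₂ (λ q p → n + suc a * suc c * d + (q + p)) Q≡ P≡ ⟨
    n + suc a * suc c * d + (Q + P)       ∎)
  n≡0 : n ≡ 0
  n≡0 = remainder-vanishes {n = n} {suc a * suc c * d} α∣ sum≡n α≡n+r (*-pos {suc a * suc c} (s≤s z≤n) 0<d)

-- With P = A d, Q = C d, R = E d and m = lcm y₂ P + n, the divisor is n + (A - 1)(C - 1)(E - 1) d.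
mobius-cube⇒lcm : ∀ {m y₀ y₁ y₂ P Q R d} → 0 < d →
  d ∣ P → d ∣ Q → d ∣ R → d < P → d < Q → d < R →
  y₀ * d ≡ P * Q → y₁ * d ≡ P * R → y₂ * d ≡ Q * R → gcd y₂ P ≡ d → lcm y₂ P ≤ m →
  alt (+ m) (+ y₂) (+ y₁) (+ R) - alt (+ y₀) (+ Q) (+ P) (+ d) ∣ℤ
    alt (+ m) (+ lcm y₂ P) (+ y₁) (+ y₁) - alt (+ y₀) (+ y₀) (+ P) (+ P) →
  m ≡ lcm y₂ P
mobius-cube⇒lcm {m} {y₀} {y₁} {y₂} {P} {Q} {R} {d} 0<d d∣P d∣Q d∣R d<P d<Q d<R y₀d y₁d y₂d gcd≡d L≤m α∣
  with a , P≡ ← proper-multiple d∣P d<P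
     | c , Q≡ ← proper-multiple d∣Q d<Q
     | e , R≡ ← proper-multiple d∣R d<R
     | n , L+n≡m ← m≤n⇒∃[o]m+o≡n L≤m =
  trans (sym L+n≡m) (trans (cong (λ t → L + t) n≡0) (+-identityʳ L))
  where
  excess : ∀ a c e d n →
    suc (suc c) * suc (suc e) * suc (suc a) * d + n + suc (suc e) * d + suc (suc c) * d + suc (suc a) * d ≡
    n + suc a * suc c * suc e * d +
      (suc (suc c) * suc (suc e) * d + suc (suc a) * suc (suc e) * d + suc (suc a) * suc (suc c) * d + d)
  excess = ℕ-Solver.solve-∀
  rearrange : ∀ l n p q s → l + n + p + q + s ≡ n + (l + p + q + s)
  rearrange = ℕ-Solver.solve-∀
  A C E L r : ℕ
  A = suc (suc a)
  C = suc (suc c)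
  E = suc (suc e)
  L = lcm y₂ P
  r = suc a * suc c * suc e * d
  y₀≡ : y₀ ≡ A * C * d
  y₀≡ = quotient-of-product {A = A} {C} 0<d y₀d P≡ Q≡
  y₁≡ : y₁ ≡ A * E * d
  y₁≡ = quotient-of-product {A = A} {E} 0<d y₁d P≡ R≡
  y₂≡ : y₂ ≡ C * E * d
  y₂≡ = quotient-of-product {A = C} {E} 0<d y₂d Q≡ R≡
  L≡ : L ≡ C * E * A * d
  L≡ = quotient-of-product {A = C * E} {A} 0<d (lcm*gcd {y₂} {P} gcd≡d) y₂≡ P≡
  sum≡n : alt (+ m) (+ L) (+ y₁) (+ y₁) - alt (+ y₀) (+ y₀) (+ P) (+ P) ≡ + n
  sum≡n = alt-alt-ℕ {m} {L} {y₁} {y₁} {y₀} {y₀} {P} {P} {n}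
    (trans (cong (λ t → t + y₁ + y₀ + P) (sym L+n≡m)) (rearrange L n y₁ y₀ P))
  α≡n+r : alt (+ m) (+ y₂) (+ y₁) (+ R) - alt (+ y₀) (+ Q) (+ P) (+ d) ≡ + (n + r)
  α≡n+r = alt-alt-ℕ {m} {y₂} {y₁} {R} {y₀} {Q} {P} {d} {n + r} (begin
    m + R + Q + P
      ≡⟨ cong₂ (λ u v → u + v + Q + P) (trans (sym L+n≡m) (cong (_+ n) L≡)) R≡ ⟩
    C * E * A * d + n + E * d + Q + P
      ≡⟨ cong₂ (λ u v → C * E * A * d + n + E * d + u + v) Q≡ P≡ ⟩
    C * E * A * d + n + E * d + C * d + A * d
      ≡⟨ excess a c e d n ⟩
    n + r + (C * E * d + A * E * d + A * C * d + d)
      ≡⟨ cong (λ t → n + r + (t + d)) (cong₂ _+_ (cong₂ _+_ y₂≡ y₁≡) y₀≡) ⟨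
    n + r + (y₂ + y₁ + y₀ + d) ∎)
  n≡0 : n ≡ 0
  n≡0 = remainder-vanishes {n = n} {r} α∣ sum≡n α≡n+r (*-pos {suc a * suc c * suc e} (s≤s z≤n) 0<d)

-- The gcd cube of m and y₀, y₁, y₂

module GcdCube (m : ℕ) (y : Fin 3 → ℕ) where

  -- Opaque, so that conversion checking never unfolds gcd on concrete cubes.
  opaque
    -- gcd 0 n = n, so 0 stands for an absent generator.
    pick : Bool → ℕ → ℕ
    pick true n = n
    pick false _ = 0

    g : Cube → ℕ
    g (p , q , r) = gcd (pick p (y 0F)) (gcd (pick q (y 1F)) (pick r (y 2F)))

    γ : Cube → ℕ
    γ V = gcd m (g V)

    gcd-pick : ∀ p q n → gcd (pick p n) (pick q n) ≡ pick (p ∨ q) n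
    gcd-pick true true n = gcd-idem n
    gcd-pick true false n = gcd-identityʳ n
    gcd-pick false q n = gcd-identityˡ (pick q n)

    gcd-g : ∀ V W → gcd (g V) (g W) ≡ g (V ∪ W)
    gcd-g (p , q , r) (p′ , q′ , r′) = begin
      gcd (gcd P (gcd Q R)) (gcd P′ (gcd Q′ R′))      ≡⟨ gcd-interchange P (gcd Q R) P′ (gcd Q′ R′) ⟩
      gcd (gcd P P′) (gcd (gcd Q R) (gcd Q′ R′))      ≡⟨ cong₂ gcd (gcd-pick p p′ (y 0F)) (gcd-interchange Q R Q′ R′) ⟩
      gcd (pick (p ∨ p′) (y 0F)) (gcd (gcd Q Q′) (gcd R R′))
        ≡⟨ cong (gcd (pick (p ∨ p′) (y 0F))) (cong₂ gcd (gcd-pick q q′ (y 1F)) (gcd-pick r r′ (y 2F))) ⟩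
      g ((p , q , r) ∪ (p′ , q′ , r′))                ∎
      where
      P Q R P′ Q′ R′ : ℕ
      P = pick p (y 0F); Q = pick q (y 1F); R = pick r (y 2F)
      P′ = pick p′ (y 0F); Q′ = pick q′ (y 1F); R′ = pick r′ (y 2F)

    gcd-γ : ∀ V W → gcd (γ V) (γ W) ≡ γ (V ∪ W)
    gcd-γ V W = begin
      gcd (gcd m (g V)) (gcd m (g W)) ≡⟨ gcd-interchange m (g V) m (g W) ⟩
      gcd (gcd m m) (gcd (g V) (g W)) ≡⟨ cong₂ gcd (gcd-idem m) (gcd-g V W) ⟩
      γ (V ∪ W)                       ∎

    g-∅ : g ∅ ≡ 0
    g-∅ = trans (gcd-identityˡ (gcd 0 0)) (gcd-identityˡ 0)

    γ-∅ : γ ∅ ≡ m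
    γ-∅ = trans (cong (gcd m) g-∅) (gcd-identityʳ m)

    g-atom : ∀ k → g (atom k) ≡ y k
    g-atom 0F = trans (cong (gcd (y 0F)) (gcd-identityˡ 0)) (gcd-identityʳ (y 0F))
    g-atom 1F = trans (gcd-identityˡ (gcd (y 1F) 0)) (gcd-identityʳ (y 1F))
    g-atom 2F = trans (gcd-identityˡ (gcd 0 (y 2F))) (gcd-identityˡ (y 2F))

    γ-pos : 0 < m → ∀ V → 0 < γ V
    γ-pos m>0 V = n≢0⇒n>0 (gcd[m,n]≢0 m (g V) (inj₁ λ m≡0 → <-irrefl (sym m≡0) m>0))

    γ≡g : ∀ {V} → g V ∣ m → γ V ≡ g V
    γ≡g = gcd-of-divisor

  g-antitone : ∀ {V W} → V ⊑ W → g W ∣ g V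
  g-antitone {V} {W} V⊑W = subst (_∣ g V) (trans (gcd-g V W) (cong g (⊑⇒∪≡ V⊑W))) (gcd[m,n]∣m (g V) (g W))

  γ-antitone : ∀ {V W} → V ⊑ W → γ W ∣ γ V
  γ-antitone {V} {W} V⊑W = subst (_∣ γ V) (trans (gcd-γ V W) (cong γ (⊑⇒∪≡ V⊑W))) (gcd[m,n]∣m (γ V) (γ W))

  γ≡g-above : ∀ {k V} → y k ∣ m → atom k ⊑ V → γ V ≡ g V
  γ≡g-above {k} yk∣m k⊑V = γ≡g (∣-trans (g-antitone k⊑V) (subst (_∣ m) (sym (g-atom k)) yk∣m))

  γ-atom : ∀ {k} → y k ∣ m → γ (atom k) ≡ y k
  γ-atom {k} yk∣m = trans (γ≡g-above yk∣m ⊑-refl) (g-atom k)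

member : ∀ {n} (T : Subset n) → 1 ≤ ∣ T ∣ → ∃ λ i → i ∈ T
member (true ∷ T) _ = zero , here
member (false ∷ T) 1≤∣T∣ with i , i∈T ← member T 1≤∣T∣ = suc i , there i∈T

two-members : ∀ {n} (T : Subset n) → 2 ≤ ∣ T ∣ → ∃₂ λ i j → i ≢ j × i ∈ T × j ∈ T
two-members (true ∷ T) (s≤s 1≤∣T∣) with j , j∈T ← member T 1≤∣T∣ = zero , suc j , (λ ()) , here , there j∈T
two-members (false ∷ T) 2≤∣T∣ with i , j , i≢j , i∈T , j∈T ← two-members T 2≤∣T∣ =
  suc i , suc j , i≢j ∘ suc-injective , there i∈T , there j∈T

module CoatomSeparation {n} (x : Fin n → ℕ) (x-inj : Injective _≡_ _≡_ x) (m : ℕ)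
                        (y : Fin 3 → ℕ) (G⇔y : ∀ z → G x m z ⇔ ∃ λ k → y k ≡ z) where
  open GcdCube m y

  gcdOver-cube : ∀ {l} (z : Fin l → ℕ) (T : Subset l) → (∀ i → i ∈ T → ∃ λ k → y k ≡ z i) →
    ∃ λ V → gcdOver z T ≡ g V × (∀ i → i ∈ T → ∃ λ k → y k ≡ z i × atom k ⊑ V)
  gcdOver-cube z [] _ = ∅ , sym g-∅ , λ ()
  gcdOver-cube z (false ∷ T) T⊆y with V , eq , below ← gcdOver-cube (z ∘ suc) T (λ i i∈T → T⊆y (suc i) (there i∈T)) =
    V , eq , λ { (suc i) (there i∈T) → below i i∈T }
  gcdOver-cube z (true ∷ T) T⊆y with k , yk≡z₀ ← T⊆y zero here
                                  | V , eq , below ← gcdOver-cube (z ∘ suc) T (λ i i∈T → T⊆y (suc i) (there i∈T)) =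
    atom k ∪ V , gcd-eq , λ { zero here → k , yk≡z₀ , ∪-upperˡ (atom k) V
                            ; (suc i) (there i∈T) → let k′ , e , k′⊑V = below i i∈T
                                                    in k′ , e , ⊑-trans k′⊑V (∪-upperʳ (atom k) V) }
    where
    gcd-eq : gcd (z zero) (gcdOver (z ∘ suc) T) ≡ g (atom k ∪ V)
    gcd-eq = trans (cong₂ gcd (trans (sym yk≡z₀) (sym (g-atom k))) eq) (gcd-g (atom k) V)

  y∣m : ∀ k → y k ∣ m
  y∣m k = proj₁ (proj₂ (proj₂ (Equivalence.from (G⇔y (y k)) (k , refl))))

  D-element : ∀ {z} → D x m z → z ≡ γ full ⊎ ∃ λ j → z ≡ γ (coatom j)
  D-element (T , T⊆G , 2≤∣T∣ , refl)
    with i , i′ , i≢i′ , i∈T , i′∈T ← two-members T 2≤∣T∣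
       | V , gcdOver≡g , below ← gcdOver-cube x T (λ i i∈T → Equivalence.to (G⇔y (x i)) (T⊆G i i∈T))
    with k , yk≡xi , k⊑V ← below i i∈T
       | k′ , yk′≡xi′ , k′⊑V ← below i′ i′∈T
    with j , k∪k′≡j ← atoms-join {k} {k′} (λ k≡k′ → i≢i′ (x-inj (trans (sym yk≡xi) (trans (cong y k≡k′) yk′≡xi′))))
    with ⋖-between (coatom⋖full j) (subst (_⊑ V) k∪k′≡j (∪-least k⊑V k′⊑V)) (⊑-full V)
       | trans gcdOver≡g (sym (γ≡g-above (y∣m k) k⊑V))
  ... | inj₁ refl | z≡γV = inj₂ (j , z≡γV)
  ... | inj₂ refl | z≡γV = inj₁ z≡γV

  coatom≢full : HasCard (D x m) 4 → ∀ j → γ (coatom j) ≢ γ full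
  coatom≢full (w , w-inj , D⇔w) j₀ γj₀≡γfull = <⇒notInjective (n<1+n 3) (λ e → w-inj (same-position e))
    where
    position : ∀ l → ∃ λ j → w l ≡ γ (coatom j)
    position l with D-element (Equivalence.from (D⇔w (w l)) (l , refl))
    ... | inj₁ wl≡γfull = j₀ , trans wl≡γfull (sym γj₀≡γfull)
    ... | inj₂ p = p
    same-position : ∀ {l l′} → proj₁ (position l) ≡ proj₁ (position l′) → w l ≡ w l′
    same-position {l} {l′} e = trans (proj₂ (position l)) (trans (cong (γ ∘ coatom) e) (sym (proj₂ (position l′))))

-- S is the gcd cube

module Lattice (x : Fin 8 → ℕ) (x-inj : Injective _≡_ _≡_ x) (gc : GcdClosed x)
               (m : ℕ) (m∈S : InS x m) (m>0 : 0 < m)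
               (y : Fin 3 → ℕ) (y-gtd : ∀ k → IsGTD x m (y k)) (y-inj : Injective _≡_ _≡_ y)
               (coatom≢full : ∀ j → GcdCube.γ m y (coatom j) ≢ GcdCube.γ m y full) where

  open GcdCube m y public

  y∈S : ∀ k → InS x (y k)
  y∈S k = proj₁ (y-gtd k)

  y<m : ∀ k → y k < m
  y<m k = proj₁ (proj₂ (y-gtd k))

  y∣m : ∀ k → y k ∣ m
  y∣m k = proj₁ (proj₂ (proj₂ (y-gtd k)))

  y-maximal : ∀ k w → InS x w → y k ∣ w → w ∣ m → w ≡ y k ⊎ w ≡ m
  y-maximal k = proj₂ (proj₂ (proj₂ (y-gtd k)))

  γ≡y : ∀ k → γ (atom k) ≡ y k
  γ≡y k = γ-atom (y∣m k)

  atom∈S : ∀ k → InS x (γ (atom k))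
  atom∈S k = subst (InS x) (sym (γ≡y k)) (y∈S k)

  join∈S : ∀ {V W} → InS x (γ V) → InS x (γ W) → InS x (γ (V ∪ W))
  join∈S {V} {W} (i , xi≡γV) (j , xj≡γW) with k , xk≡gcd ← gc i j =
    k , trans xk≡gcd (trans (cong₂ gcd xi≡γV xj≡γW) (gcd-γ V W))

  γ∈S : ∀ V → InS x (γ V)
  γ∈S (false , false , false) = subst (InS x) (sym γ-∅) m∈S
  γ∈S (true , false , false) = atom∈S 0F
  γ∈S (false , true , false) = atom∈S 1F
  γ∈S (false , false , true) = atom∈S 2F
  γ∈S (true , true , false) = join∈S (atom∈S 0F) (atom∈S 1F)
  γ∈S (true , false , true) = join∈S (atom∈S 0F) (atom∈S 2F)
  γ∈S (false , true , true) = join∈S (atom∈S 1F) (atom∈S 2F)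
  γ∈S (true , true , true) = join∈S (join∈S (atom∈S 0F) (atom∈S 1F)) (atom∈S 2F)

  ∅≢atom : ∀ k → γ ∅ ≢ γ (atom k)
  ∅≢atom k e = <-irrefl (trans (sym (γ≡y k)) (trans (sym e) γ-∅)) (y<m k)

  atom≢join : ∀ {j k} → j ≢ k → γ (atom j) ≢ γ (atom j ∪ atom k)
  atom≢join {j} {k} j≢k γj≡γjk =
    [ (λ yk≡yj → j≢k (y-inj (sym yk≡yj))) , (λ yk≡m → <-irrefl yk≡m (y<m k)) ]′ (y-maximal j (y k) (y∈S k) yj∣yk (y∣m k))
    where
    yj∣yk : y j ∣ y k
    yj∣yk = subst₂ _∣_ (trans (sym γj≡γjk) (γ≡y j)) (γ≡y k) (γ-antitone (∪-upperʳ (atom j) (atom k)))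

  -- The three ranks of covers are strict for three different reasons: y_k < m,
  -- the y_k are pairwise incomparable, and |D_S(m)| = 4.
  ⋖-strict : ∀ {V W} → V ⋖ W → γ V ≢ γ W
  ⋖-strict (cover₁ {false} {false}) = ∅≢atom 0F
  ⋖-strict (cover₁ {true} {false}) = atom≢join {1F} {0F} (λ ())
  ⋖-strict (cover₁ {false} {true}) = atom≢join {2F} {0F} (λ ())
  ⋖-strict (cover₁ {true} {true}) = coatom≢full 0F
  ⋖-strict (cover₂ {false} {false}) = ∅≢atom 1F
  ⋖-strict (cover₂ {true} {false}) = atom≢join {0F} {1F} (λ ())
  ⋖-strict (cover₂ {false} {true}) = atom≢join {2F} {1F} (λ ())
  ⋖-strict (cover₂ {true} {true}) = coatom≢full 1F
  ⋖-strict (cover₃ {false} {false}) = ∅≢atom 2F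
  ⋖-strict (cover₃ {true} {false}) = atom≢join {0F} {2F} (λ ())
  ⋖-strict (cover₃ {false} {true}) = atom≢join {1F} {2F} (λ ())
  ⋖-strict (cover₃ {true} {true}) = coatom≢full 2F

  ⋖⇒γ< : ∀ {V W} → V ⋖ W → γ W < γ V
  ⋖⇒γ< {V} V⋖W = ≤∧≢⇒< (∣⇒≤ ⦃ >-nonZero (γ-pos m>0 V) ⦄ (γ-antitone (⋖⇒⊑ V⋖W))) (⋖-strict V⋖W ∘ sym)

  γ-strict : ∀ {V W} → V ⊑ W → V ≢ W → γ V ≢ γ W
  γ-strict V⊑W V≢W γV≡γW with V′ , V⋖V′ , V′⊑W ← ⊏⇒⋖⊑ V⊑W V≢W =
    ⋖-strict V⋖V′ (∣-antisym (subst (_∣ γ V′) (sym γV≡γW) (γ-antitone V′⊑W)) (γ-antitone (⋖⇒⊑ V⋖V′)))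

  γ-absorbs : ∀ {V W} → γ V ≡ γ W → V ∪ W ≡ V
  γ-absorbs {V} {W} γV≡γW with (V ∪ W) ≟ᶜ V
  ... | yes eq = eq
  ... | no neq = ⊥-elim (γ-strict (∪-upperˡ V W) (neq ∘ sym) (sym (begin
    γ (V ∪ W)       ≡⟨ gcd-γ V W ⟨
    gcd (γ V) (γ W) ≡⟨ cong (gcd (γ V)) γV≡γW ⟨
    gcd (γ V) (γ V) ≡⟨ gcd-idem (γ V) ⟩
    γ V             ∎)))

  γ-injective : Injective _≡_ _≡_ γ
  γ-injective {V} {W} γV≡γW = begin
    V     ≡⟨ γ-absorbs γV≡γW ⟨
    V ∪ W ≡⟨ ∪-comm V W ⟩
    W ∪ V ≡⟨ γ-absorbs (sym γV≡γW) ⟩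
    W     ∎

  γ-reflects : ∀ {V W} → γ W ∣ γ V → V ⊑ W
  γ-reflects {V} {W} γW∣γV = ∪≡⇒⊑ V W (γ-injective (trans (sym (gcd-γ V W)) (gcd-of-divisor γW∣γV)))

  -- Opaque, so that with-abstraction over index and point does not run the search in locate.
  opaque
    index : Cube → Fin 8
    index V = proj₁ (γ∈S V)

    x-index : ∀ V → x (index V) ≡ γ V
    x-index V = proj₂ (γ∈S V)

    -- An element outside γ(Cube) together with the eight indices of γ(Cube) would be
    -- nine distinct indices in Fin 8.
    locate : ∀ k → ∃ λ V → x k ≡ γ V
    locate k with any? (λ j → x k ≟ γ (enumerate j))
    ... | yes (j , xk≡γ) = enumerate j , xk≡γ
    ... | no ∄ = ⊥-elim (<⇒notInjective (n<1+n 8) extended-injective)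
      where
      extended : Fin 9 → Fin 8
      extended zero = k
      extended (suc j) = index (enumerate j)
      extended-injective : Injective _≡_ _≡_ extended
      extended-injective {zero} {zero} _ = refl
      extended-injective {zero} {suc j} e = ⊥-elim (∄ (j , trans (cong x e) (x-index _)))
      extended-injective {suc i} {zero} e = ⊥-elim (∄ (i , trans (cong x (sym e)) (x-index _)))
      extended-injective {suc i} {suc j} e =
        cong suc (enumerate-injective (γ-injective (trans (sym (x-index _)) (trans (cong x e) (x-index _)))))

    point : Fin 8 → Cube
    point k = proj₁ (locate k)

    x-point : ∀ k → x k ≡ γ (point k)
    x-point k = proj₂ (locate k)

  S⊆γ : ∀ {w} → InS x w → ∃ λ V → w ≡ γ V
  S⊆γ (i , refl) = locate i

  gtd⇒⋖ : ∀ {V W} → IsGTD x (γ V) (γ W) → V ⋖ W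
  gtd⇒⋖ {V} {W} (_ , γW<γV , γW∣γV , maximal)
    with V′ , V⋖V′ , V′⊑W ← ⊏⇒⋖⊑ (γ-reflects γW∣γV) (λ V≡W → <-irrefl (cong γ (sym V≡W)) γW<γV)
    with maximal (γ V′) (γ∈S V′) (γ-antitone V′⊑W) (γ-antitone (⋖⇒⊑ V⋖V′))
  ... | inj₁ γV′≡γW = subst (V ⋖_) (γ-injective γV′≡γW) V⋖V′
  ... | inj₂ γV′≡γV = ⊥-elim (⋖-strict V⋖V′ (sym γV′≡γV))

  ⋖⇒gtd : ∀ {V W} → V ⋖ W → IsGTD x (γ V) (γ W)
  ⋖⇒gtd {V} {W} V⋖W = γ∈S W , ⋖⇒γ< V⋖W , γ-antitone (⋖⇒⊑ V⋖W) , maximal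
    where
    maximal : ∀ w → InS x w → γ W ∣ w → w ∣ γ V → w ≡ γ W ⊎ w ≡ γ V
    maximal w w∈S γW∣w w∣γV with U , refl ← S⊆γ w∈S with ⋖-between V⋖W (γ-reflects w∣γV) (γ-reflects γW∣w)
    ... | inj₁ refl = inj₂ refl
    ... | inj₂ refl = inj₁ refl

  LcmCovers : Set
  LcmCovers = ∀ {V W W′} → V ⋖ W → V ⋖ W′ → W ≢ W′ → lcm (γ W) (γ W′) ≡ γ V

  M⇒lcmCovers : SatisfiesM x → LcmCovers
  M⇒lcmCovers M {V} {W} {W′} V⋖W V⋖W′ W≢W′ =
    M (γ V) (γ∈S V) (γ W , γ W′ , γW≢γW′ , ⋖⇒gtd V⋖W , ⋖⇒gtd V⋖W′)
      (γ W) (γ W′) (⋖⇒gtd V⋖W) (⋖⇒gtd V⋖W′) γW≢γW′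
    where
    γW≢γW′ : γ W ≢ γ W′
    γW≢γW′ = W≢W′ ∘ γ-injective

  lcmCovers⇒M : LcmCovers → SatisfiesM x
  lcmCovers⇒M lcm-covers _ v∈S _ _ _ z∈G z′∈G z≢z′
    with V , refl ← S⊆γ v∈S | W , refl ← S⊆γ (proj₁ z∈G) | W′ , refl ← S⊆γ (proj₁ z′∈G) =
    lcm-covers (gtd⇒⋖ z∈G) (gtd⇒⋖ z′∈G) (z≢z′ ∘ cong γ)

  module Weights (lcm-covers : LcmCovers) where

    cover-product : ∀ {V W W′} → V ⋖ W → V ⋖ W′ → W ≢ W′ → γ W * γ W′ ≡ γ (W ∪ W′) * γ V
    cover-product {V} {W} {W′} V⋖W V⋖W′ W≢W′ = begin
      γ W * γ W′                          ≡⟨ gcd*lcm (γ W) (γ W′) ⟨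
      gcd (γ W) (γ W′) * lcm (γ W) (γ W′) ≡⟨ cong₂ _*_ (gcd-γ W W′) (lcm-covers V⋖W V⋖W′ W≢W′) ⟩
      γ (W ∪ W′) * γ V                    ∎

    cofactor : Fin 3 → ℕ
    cofactor k = quotient (y∣m k)

    weigh : Bool → ℕ → ℕ
    weigh true n = n
    weigh false _ = 1

    -- weight V = ∏_{k ∈ V} m / y_k; γ-weight shows that γ V = m / weight V.
    weight : Cube → ℕ
    weight (p , q , r) = weigh p (cofactor 0F) * weigh q (cofactor 1F) * weigh r (cofactor 2F)

    weight-pos : ∀ V → 0 < weight V
    weight-pos (p , q , r) = *-pos (*-pos (weigh-pos p 0F) (weigh-pos q 1F)) (weigh-pos r 2F)
      where
      weigh-pos : ∀ p k → 0 < weigh p (cofactor k)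
      weigh-pos false _ = s≤s z≤n
      weigh-pos true k = n≢0⇒n>0 λ c≡0 → <-irrefl (sym (trans (_∣_.equality (y∣m k)) (cong (_* y k) c≡0))) m>0

    weight-∪-∩ : ∀ S T → weight (S ∪ T) * weight (S ∩ T) ≡ weight S * weight T
    weight-∪-∩ (p , q , r) (p′ , q′ , r′) = begin
      (weigh (p ∨ p′) A * weigh (q ∨ q′) B * weigh (r ∨ r′) C) * (weigh (p ∧ p′) A * weigh (q ∧ q′) B * weigh (r ∧ r′) C)
        ≡⟨ regroup (weigh (p ∨ p′) A) (weigh (q ∨ q′) B) (weigh (r ∨ r′) C)
                   (weigh (p ∧ p′) A) (weigh (q ∧ q′) B) (weigh (r ∧ r′) C) ⟩
      (weigh (p ∨ p′) A * weigh (p ∧ p′) A) * (weigh (q ∨ q′) B * weigh (q ∧ q′) B) * (weigh (r ∨ r′) C * weigh (r ∧ r′) C)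
        ≡⟨ cong₂ _*_ (cong₂ _*_ (weigh-∨-∧ p p′ A) (weigh-∨-∧ q q′ B)) (weigh-∨-∧ r r′ C) ⟩
      (weigh p A * weigh p′ A) * (weigh q B * weigh q′ B) * (weigh r C * weigh r′ C)
        ≡⟨ regroup (weigh p A) (weigh q B) (weigh r C) (weigh p′ A) (weigh q′ B) (weigh r′ C) ⟨
      (weigh p A * weigh q B * weigh r C) * (weigh p′ A * weigh q′ B * weigh r′ C) ∎
      where
      A B C : ℕ
      A = cofactor 0F; B = cofactor 1F; C = cofactor 2F
      regroup : ∀ a b c a′ b′ c′ → (a * b * c) * (a′ * b′ * c′) ≡ (a * a′) * (b * b′) * (c * c′)
      regroup = ℕ-Solver.solve-∀
      weigh-∨-∧ : ∀ p p′ n → weigh (p ∨ p′) n * weigh (p ∧ p′) n ≡ weigh p n * weigh p′ n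
      weigh-∨-∧ true true n = refl
      weigh-∨-∧ true false n = refl
      weigh-∨-∧ false true n = *-comm n 1
      weigh-∨-∧ false false n = refl

    weight-∅ : γ ∅ * weight ∅ ≡ m
    weight-∅ = trans (*-identityʳ (γ ∅)) γ-∅

    weight-atom : ∀ k → γ (atom k) * weight (atom k) ≡ m
    weight-atom k = trans (cong₂ _*_ (γ≡y k) (single k)) (trans (*-comm (y k) (cofactor k)) (sym (_∣_.equality (y∣m k))))
      where
      single : ∀ k → weight (atom k) ≡ cofactor k
      single 0F = trans (*-identityʳ _) (*-identityʳ _)
      single 1F = trans (*-identityʳ _) (*-identityˡ _)
      single 2F = *-identityˡ _

    weight-step : ∀ {V W W′} → V ⋖ W → V ⋖ W′ → W ≢ W′ →
      γ V * weight V ≡ m → γ W * weight W ≡ m → γ W′ * weight W′ ≡ m → γ (W ∪ W′) * weight (W ∪ W′) ≡ m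
    weight-step {V} {W} {W′} V⋖W V⋖W′ W≢W′ eqV eqW eqW′ = cancelʳ m>0 (begin
      (γ U * weight U) * m                    ≡⟨ cong ((γ U * weight U) *_) eqV ⟨
      (γ U * weight U) * (γ V * weight V)     ≡⟨ interchange (γ U) (weight U) (γ V) (weight V) ⟩
      (γ U * γ V) * (weight U * weight V)     ≡⟨ cong₂ _*_ (cover-product V⋖W V⋖W′ W≢W′) (sym weights) ⟨
      (γ W * γ W′) * (weight W * weight W′)   ≡⟨ interchange (γ W) (γ W′) (weight W) (weight W′) ⟩
      (γ W * weight W) * (γ W′ * weight W′)   ≡⟨ cong₂ _*_ eqW eqW′ ⟩
      m * m                                   ∎)
      where
      U : Cube
      U = W ∪ W′
      weights : weight U * weight V ≡ weight W * weight W′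
      weights = trans (cong (weight U *_) (cong weight (sym (⋖-meet V⋖W V⋖W′ W≢W′)))) (weight-∪-∩ W W′)

    weight-coatom : ∀ k → γ (coatom k) * weight (coatom k) ≡ m
    weight-coatom 0F = weight-step cover₂ cover₃ (λ ()) weight-∅ (weight-atom 1F) (weight-atom 2F)
    weight-coatom 1F = weight-step cover₁ cover₃ (λ ()) weight-∅ (weight-atom 0F) (weight-atom 2F)
    weight-coatom 2F = weight-step cover₁ cover₂ (λ ()) weight-∅ (weight-atom 0F) (weight-atom 1F)

    γ-weight : ∀ V → γ V * weight V ≡ m
    γ-weight (false , false , false) = weight-∅
    γ-weight (true , false , false) = weight-atom 0F
    γ-weight (false , true , false) = weight-atom 1F
    γ-weight (false , false , true) = weight-atom 2F
    γ-weight (false , true , true) = weight-coatom 0F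
    γ-weight (true , false , true) = weight-coatom 1F
    γ-weight (true , true , false) = weight-coatom 2F
    γ-weight (true , true , true) = weight-step cover₂ cover₃ (λ ()) (weight-atom 0F) (weight-coatom 2F) (weight-coatom 1F)

    γ-∪-∁ : ∀ S T → γ (S ∪ ∁ T) * weight (∁ T) ≡ γ (S ∩ T)
    γ-∪-∁ S T = cancelʳ (weight-pos (S ∩ T)) (begin
      γ (S ∪ ∁ T) * weight (∁ T) * weight (S ∩ T)
        ≡⟨ *-assoc (γ (S ∪ ∁ T)) (weight (∁ T)) (weight (S ∩ T)) ⟩
      γ (S ∪ ∁ T) * (weight (∁ T) * weight (S ∩ T))
        ≡⟨ cong (γ (S ∪ ∁ T) *_) (weight-∪-∩ (∁ T) (S ∩ T)) ⟨
      γ (S ∪ ∁ T) * (weight (∁ T ∪ S ∩ T) * weight (∁ T ∩ S ∩ T))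
        ≡⟨ cong₂ (λ U V → γ (S ∪ ∁ T) * (weight U * weight V)) (∁-∪-∩ S T) (∁-∩-∩ S T) ⟩
      γ (S ∪ ∁ T) * (weight (S ∪ ∁ T) * 1)
        ≡⟨ cong (γ (S ∪ ∁ T) *_) (*-identityʳ (weight (S ∪ ∁ T))) ⟩
      γ (S ∪ ∁ T) * weight (S ∪ ∁ T) ≡⟨ γ-weight (S ∪ ∁ T) ⟩
      m                              ≡⟨ γ-weight (S ∩ T) ⟨
      γ (S ∩ T) * weight (S ∩ T)     ∎)

    γ-modular : ∀ S T → γ S * γ T ≡ γ (S ∪ T) * γ (S ∩ T)
    γ-modular S T = cancelʳ (*-pos (weight-pos S) (weight-pos T)) (begin
      (γ S * γ T) * (weight S * weight T)                     ≡⟨ interchange (γ S) (γ T) (weight S) (weight T) ⟩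
      (γ S * weight S) * (γ T * weight T)                     ≡⟨ cong₂ _*_ (γ-weight S) (γ-weight T) ⟩
      m * m                                                   ≡⟨ cong₂ _*_ (γ-weight (S ∪ T)) (γ-weight (S ∩ T)) ⟨
      (γ (S ∪ T) * weight (S ∪ T)) * (γ (S ∩ T) * weight (S ∩ T))
        ≡⟨ interchange (γ (S ∪ T)) (weight (S ∪ T)) (γ (S ∩ T)) (weight (S ∩ T)) ⟩
      (γ (S ∪ T) * γ (S ∩ T)) * (weight (S ∪ T) * weight (S ∩ T)) ≡⟨ cong ((γ (S ∪ T) * γ (S ∩ T)) *_) (weight-∪-∩ S T) ⟩
      (γ (S ∪ T) * γ (S ∩ T)) * (weight S * weight T)         ∎)

    lcm-γ : ∀ S T → lcm (γ S) (γ T) ≡ γ (S ∩ T)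
    lcm-γ S T = cancelʳ (γ-pos m>0 (S ∪ T)) (begin
      lcm (γ S) (γ T) * γ (S ∪ T)         ≡⟨ cong (lcm (γ S) (γ T) *_) (gcd-γ S T) ⟨
      lcm (γ S) (γ T) * gcd (γ S) (γ T)   ≡⟨ *-comm (lcm (γ S) (γ T)) (gcd (γ S) (γ T)) ⟩
      gcd (γ S) (γ T) * lcm (γ S) (γ T)   ≡⟨ gcd*lcm (γ S) (γ T) ⟩
      γ S * γ T                           ≡⟨ γ-modular S T ⟩
      γ (S ∪ T) * γ (S ∩ T)               ≡⟨ *-comm (γ (S ∪ T)) (γ (S ∩ T)) ⟩
      γ (S ∩ T) * γ (S ∪ T)               ∎)

    factor : Matrix 8
    factor k j with k ≟ᶠ index (∁ (point j))
    ... | yes _ = + weight (∁ (point j))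
    ... | no _ = + 0

    factor-off : ∀ {k j} → k ≢ index (∁ (point j)) → factor k j ≡ + 0
    factor-off {k} {j} k≢ with k ≟ᶠ index (∁ (point j))
    ... | yes k≡ = ⊥-elim (k≢ k≡)
    ... | no _ = refl

    factor-on : ∀ j → factor (index (∁ (point j))) j ≡ + weight (∁ (point j))
    factor-on j with index (∁ (point j)) ≟ᶠ index (∁ (point j))
    ... | yes _ = refl
    ... | no k≢k = ⊥-elim (k≢k refl)

    gcd⊗factor≡lcm : ∀ i j → LCMMatrix x i j ≡ (GCDMatrix x ⊗ factor) i j
    gcd⊗factor≡lcm i j = sym (begin
      sumFin (λ k → + gcd (x i) (x k) ℤ.* factor k j)
        ≡⟨ sumFin-select (λ k → + gcd (x i) (x k) ℤ.* factor k j) k₀ others-vanish ⟩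
      + gcd (x i) (x k₀) ℤ.* factor k₀ j       ≡⟨ cong (+ gcd (x i) (x k₀) ℤ.*_) (factor-on j) ⟩
      + gcd (x i) (x k₀) ℤ.* + weight (∁ T)    ≡⟨ ℤ.pos-* (gcd (x i) (x k₀)) (weight (∁ T)) ⟨
      + (gcd (x i) (x k₀) * weight (∁ T))      ≡⟨ cong (λ n → + (n * weight (∁ T))) gcd≡ ⟩
      + (γ (S ∪ ∁ T) * weight (∁ T))           ≡⟨ cong +_ (trans (γ-∪-∁ S T) (sym (lcm-γ S T))) ⟩
      + lcm (γ S) (γ T)                        ≡⟨ cong₂ (λ a b → + lcm a b) (x-point i) (x-point j) ⟨
      + lcm (x i) (x j)                        ∎)
      where
      S T : Cube
      S = point i
      T = point j
      k₀ : Fin 8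
      k₀ = index (∁ T)
      others-vanish : ∀ k → k ≢ k₀ → + gcd (x i) (x k) ℤ.* factor k j ≡ + 0
      others-vanish k k≢k₀ = trans (cong (+ gcd (x i) (x k) ℤ.*_) (factor-off k≢k₀)) (ℤ.*-zeroʳ (+ gcd (x i) (x k)))
      gcd≡ : gcd (x i) (x k₀) ≡ γ (S ∪ ∁ T)
      gcd≡ = trans (cong₂ gcd (x-point i) (x-index (∁ T))) (gcd-γ S (∁ T))

    gcd∣lcm : GCDMatrix x ∣ₘ LCMMatrix x
    gcd∣lcm = factor , inj₁ gcd⊗factor≡lcm

  Column : Cube → Set
  Column T = ∃ λ (c : Fin 8 → ℤ.ℤ) → ∀ V → + lcm (γ V) (γ T) ≡ sumFin (λ k → + γ (V ∪ point k) ℤ.* c k)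

  gcd-index-point : ∀ V k → gcd (x (index V)) (x k) ≡ γ (V ∪ point k)
  gcd-index-point V k = trans (cong₂ gcd (x-index V) (x-point k)) (gcd-γ V (point k))

  column : GCDMatrix x ∣ₘ LCMMatrix x → ∀ T → Column T
  column (C , inj₁ lcm≡gcd⊗C) T = (λ k → C k (index T)) , λ V → begin
    + lcm (γ V) (γ T)                                           ≡⟨ cong₂ (λ a b → + lcm a b) (x-index V) (x-index T) ⟨
    + lcm (x (index V)) (x (index T))                           ≡⟨ lcm≡gcd⊗C (index V) (index T) ⟩
    sumFin (λ k → + gcd (x (index V)) (x k) ℤ.* C k (index T))
      ≡⟨ sumFin-cong (λ k → cong (λ n → + n ℤ.* C k (index T)) (gcd-index-point V k)) ⟩
    sumFin (λ k → + γ (V ∪ point k) ℤ.* C k (index T))          ∎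
  column (C , inj₂ lcm≡C⊗gcd) T = (λ k → C (index T) k) , λ V → begin
    + lcm (γ V) (γ T)                                           ≡⟨ cong +_ (lcm-comm (γ V) (γ T)) ⟩
    + lcm (γ T) (γ V)                                           ≡⟨ cong₂ (λ a b → + lcm a b) (x-index T) (x-index V) ⟨
    + lcm (x (index T)) (x (index V))                           ≡⟨ lcm≡C⊗gcd (index T) (index V) ⟩
    sumFin (λ k → C (index T) k ℤ.* + gcd (x k) (x (index V)))
      ≡⟨ sumFin-cong (λ k → trans (ℤ.*-comm (C (index T) k) (+ gcd (x k) (x (index V))))
           (cong (λ n → + n ℤ.* C (index T) k) (trans (gcd-comm (x k) (x (index V))) (gcd-index-point V k)))) ⟩
    sumFin (λ k → + γ (V ∪ point k) ℤ.* C (index T) k)          ∎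

  module FromDivisibility (gcd∣lcm : GCDMatrix x ∣ₘ LCMMatrix x) where

    mobius-divides : ∀ {Y is} → FreeIn Y is → ∀ T → ∇ is (λ V → + γ V) Y ∣ℤ ∇ is (λ V → + lcm (γ V) (γ T)) Y
    mobius-divides free T with c , col ← column gcd∣lcm T = ∇-divides free (λ V → + γ V) _ point c col

    lcm∣γ : ∀ {V W W′} → V ⊑ W → V ⊑ W′ → lcm (γ W) (γ W′) ∣ γ V
    lcm∣γ V⊑W V⊑W′ = lcm-least (γ-antitone V⊑W) (γ-antitone V⊑W′)

    γ≡lcm-covers : ∀ {Y i j} → FreeIn Y (i ∷ j ∷ []) → (Y ∪ atom i) ⋖ full → (Y ∪ atom j) ⋖ full →
      (Y ∪ atom i) ∪ atom j ≡ full → (Y ∪ atom i) ∪ (Y ∪ atom j) ≡ full →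
      γ Y ≡ lcm (γ (Y ∪ atom i)) (γ (Y ∪ atom j))
    γ≡lcm-covers {Y} {i} {j} free P⋖full Q⋖full PQ≡full P∪Q≡full =
      mobius-square⇒lcm (γ-pos m>0 _) gcd≡ (subst (_< γ P) (cong γ (sym PQ≡full)) (⋖⇒γ< P⋖full))
        (subst (_< γ Q) (cong γ (sym PQ≡full)) (⋖⇒γ< Q⋖full))
        (∣⇒≤ ⦃ >-nonZero (γ-pos m>0 Y) ⦄ (lcm∣γ (∪-upperˡ Y (atom i)) (∪-upperˡ Y (atom j))))
        (subst (∇ (i ∷ j ∷ []) (λ V → + γ V) Y ∣ℤ_) column≡ (mobius-divides free P))
      where
      P Q : Cube
      P = Y ∪ atom i
      Q = Y ∪ atom j
      gcd≡ : gcd (γ P) (γ Q) ≡ γ (P ∪ atom j)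
      gcd≡ = trans (gcd-γ P Q) (cong γ (trans P∪Q≡full (sym PQ≡full)))
      column≡ : ∇ (i ∷ j ∷ []) (λ V → + lcm (γ V) (γ P)) Y ≡ alt (+ γ Y) (+ lcm (γ P) (γ Q)) (+ γ P) (+ γ P)
      column≡ = alt-cong (lcm-of-divisor (γ-antitone (∪-upperˡ Y (atom i)))) (lcm-comm (γ Q) (γ P)) (lcm-idem (γ P))
        (trans (lcm-comm _ (γ P)) (lcm-of-divisor (γ-antitone (∪-upperˡ P (atom j)))))

    γ₁₀₀ : γ (atom 0F) ≡ lcm (γ (coatom 2F)) (γ (coatom 1F))
    γ₁₀₀ = γ≡lcm-covers (λ { 0F () ; 1F _ → here refl ; 2F _ → there (here refl) }) cover₃ cover₂ refl refl

    γ₀₁₀ : γ (atom 1F) ≡ lcm (γ (coatom 2F)) (γ (coatom 0F))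
    γ₀₁₀ = γ≡lcm-covers (λ { 0F _ → here refl ; 1F () ; 2F _ → there (here refl) }) cover₃ cover₁ refl refl

    γ₀₀₁ : γ (atom 2F) ≡ lcm (γ (coatom 1F)) (γ (coatom 0F))
    γ₀₀₁ = γ≡lcm-covers (λ { 0F _ → here refl ; 1F _ → there (here refl) ; 2F () }) cover₂ cover₁ refl refl

    lcm-product : ∀ {y V W} → y ≡ lcm (γ V) (γ W) → y * γ (V ∪ W) ≡ γ V * γ W
    lcm-product {V = V} {W} refl = lcm*gcd {γ V} {γ W} (gcd-γ V W)

    -- The Möbius sum of the column of γ (coatom 2F) over the whole cube collapses, by γ₁₀₀ and
    -- γ₀₁₀, to m − lcm (y₂, γ (coatom 2F)).
    γ∅≡lcm : γ ∅ ≡ lcm (γ (atom 2F)) (γ (coatom 2F))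
    γ∅≡lcm = mobius-cube⇒lcm {γ ∅} {γ (atom 0F)} {γ (atom 1F)} {γ (atom 2F)}
                             {γ (coatom 2F)} {γ (coatom 1F)} {γ (coatom 0F)} {γ full}
      (γ-pos m>0 full)
      (γ-antitone (⊑-full (coatom 2F))) (γ-antitone (⊑-full (coatom 1F))) (γ-antitone (⊑-full (coatom 0F)))
      (⋖⇒γ< (coatom⋖full 2F)) (⋖⇒γ< (coatom⋖full 1F)) (⋖⇒γ< (coatom⋖full 0F))
      (lcm-product γ₁₀₀) (lcm-product γ₀₁₀) (lcm-product γ₀₀₁) (gcd-γ (atom 2F) (coatom 2F))
      (∣⇒≤ ⦃ >-nonZero (γ-pos m>0 ∅) ⦄ (lcm∣γ (∅⊑ (atom 2F)) (∅⊑ (coatom 2F))))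
      (subst (∇ (0F ∷ 1F ∷ 2F ∷ []) (λ V → + γ V) ∅ ∣ℤ_) column≡ (mobius-divides free (coatom 2F)))
      where
      free : FreeIn ∅ (0F ∷ 1F ∷ 2F ∷ [])
      free = λ { 0F _ → here refl ; 1F _ → there (here refl) ; 2F _ → there (there (here refl)) }
      column≡ : ∇ (0F ∷ 1F ∷ 2F ∷ []) (λ V → + lcm (γ V) (γ (coatom 2F))) ∅ ≡
        alt (+ γ ∅) (+ lcm (γ (atom 2F)) (γ (coatom 2F))) (+ γ (atom 1F)) (+ γ (atom 1F)) ℤ.-
        alt (+ γ (atom 0F)) (+ γ (atom 0F)) (+ γ (coatom 2F)) (+ γ (coatom 2F))
      column≡ = cong₂ ℤ._-_
        (alt-cong (lcm-of-divisor (γ-antitone (∅⊑ (coatom 2F)))) (refl {x = lcm (γ (atom 2F)) (γ (coatom 2F))})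
          (lcm-of-divisor (γ-antitone (⋖⇒⊑ (cover₁ {true} {false}))))
          (trans (lcm-comm (γ (coatom 0F)) (γ (coatom 2F))) (sym γ₀₁₀)))
        (alt-cong (lcm-of-divisor (γ-antitone (⋖⇒⊑ (cover₂ {true} {false}))))
          (trans (lcm-comm (γ (coatom 1F)) (γ (coatom 2F))) (sym γ₁₀₀))
          (lcm-idem (γ (coatom 2F)))
          (trans (lcm-comm (γ full) (γ (coatom 2F))) (lcm-of-divisor (γ-antitone (⊑-full (coatom 2F))))))

    coatom∣lcm : ∀ {k k′} → k ≢ k′ → ∀ j → γ (coatom j) ∣ lcm (γ (atom k)) (γ (atom k′))
    coatom∣lcm {k} {k′} k≢k′ j with k ≟ᶠ j
    ... | no k≢j = ∣-trans (γ-antitone (atom⊑coatom k≢j)) (m∣lcm[m,n] (γ (atom k)) (γ (atom k′)))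
    ... | yes refl = ∣-trans (γ-antitone (atom⊑coatom (k≢k′ ∘ sym))) (n∣lcm[m,n] (γ (atom k)) (γ (atom k′)))

    lcm-atoms≡γ∅ : ∀ {k k′} → k ≢ k′ → lcm (γ (atom k)) (γ (atom k′)) ≡ γ ∅
    lcm-atoms≡γ∅ {k} {k′} k≢k′ = ∣-antisym (lcm∣γ (∅⊑ (atom k)) (∅⊑ (atom k′)))
      (subst (_∣ L) (sym γ∅≡lcm) (lcm-least y₂∣L (coatom∣lcm k≢k′ 2F)))
      where
      L : ℕ
      L = lcm (γ (atom k)) (γ (atom k′))
      y₂∣L : γ (atom 2F) ∣ L
      y₂∣L = subst (_∣ L) (sym γ₀₀₁) (lcm-least (coatom∣lcm k≢k′ 1F) (coatom∣lcm k≢k′ 0F))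

    lcm-covers : LcmCovers
    lcm-covers cover₁ cover₁ W≢W′ = ⊥-elim (W≢W′ refl)
    lcm-covers cover₂ cover₂ W≢W′ = ⊥-elim (W≢W′ refl)
    lcm-covers cover₃ cover₃ W≢W′ = ⊥-elim (W≢W′ refl)
    lcm-covers (cover₁ {c = false}) cover₂ _ = lcm-atoms≡γ∅ {0F} {1F} (λ ())
    lcm-covers (cover₁ {b = false}) cover₃ _ = lcm-atoms≡γ∅ {0F} {2F} (λ ())
    lcm-covers (cover₂ {c = false}) cover₁ _ = lcm-atoms≡γ∅ {1F} {0F} (λ ())
    lcm-covers (cover₂ {a = false}) cover₃ _ = lcm-atoms≡γ∅ {1F} {2F} (λ ())
    lcm-covers (cover₃ {b = false}) cover₁ _ = lcm-atoms≡γ∅ {2F} {0F} (λ ())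
    lcm-covers (cover₃ {a = false}) cover₂ _ = lcm-atoms≡γ∅ {2F} {1F} (λ ())
    lcm-covers (cover₁ {c = true}) cover₂ _ = sym γ₀₀₁
    lcm-covers (cover₂ {c = true}) cover₁ _ = trans (lcm-comm (γ (coatom 0F)) (γ (coatom 1F))) (sym γ₀₀₁)
    lcm-covers (cover₁ {b = true}) cover₃ _ = sym γ₀₁₀
    lcm-covers (cover₃ {b = true}) cover₁ _ = trans (lcm-comm (γ (coatom 0F)) (γ (coatom 2F))) (sym γ₀₁₀)
    lcm-covers (cover₂ {a = true}) cover₃ _ = sym γ₁₀₀
    lcm-covers (cover₃ {a = true}) cover₂ _ = trans (lcm-comm (γ (coatom 1F)) (γ (coatom 2F))) (sym γ₁₀₀)

strictlyIncreasing⇒injective : ∀ {n} {x : Fin n → ℕ} → StrictlyIncreasing x → Injective _≡_ _≡_ x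
strictlyIncreasing⇒injective {x = x} increasing {i} {j} xi≡xj with <-cmp i j
... | tri< i<j _ _ = ⊥-elim (<-irrefl xi≡xj (increasing i j i<j))
... | tri≈ _ i≡j _ = i≡j
... | tri> _ _ j<i = ⊥-elim (<-irrefl (sym xi≡xj) (increasing j i j<i))

theorem3p6 : (x : Fin 8 → ℕ) → StrictlyIncreasing x → Positive x → GcdClosed x →
    HasCard (G x (x (fromℕ 7))) 3 → HasCard (D x (x (fromℕ 7))) 4 →
    (GCDMatrix x ∣ₘ LCMMatrix x) ⇔ SatisfiesM x
theorem3p6 x increasing positive gcd-closed (y , y-inj , G⇔y) D-card =
  mk⇔ (lcmCovers⇒M ∘ FromDivisibility.lcm-covers) (Weights.gcd∣lcm ∘ M⇒lcmCovers)
  where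
  x-inj : Injective _≡_ _≡_ x
  x-inj = strictlyIncreasing⇒injective increasing
  top : Fin 8
  top = fromℕ 7
  open CoatomSeparation x x-inj (x top) y G⇔y using (coatom≢full)
  open Lattice x x-inj gcd-closed (x top) (top , refl) (positive top)
    y (λ k → Equivalence.from (G⇔y (y k)) (k , refl)) y-inj (coatom≢full D-card)
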